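{- Let $K_{m,n}$ be a complete bipartite graph with parts of cardinality $m$ and $n$, where $m$ is odd, $n$ is even, and $m>n \geq 2$. Then $EBI(K_{m,2}) = \{0\}$. For $n\geq 4$, let $q$ be the quotient when $m$ is divided by $\frac{n}{2}+1$ and let $r$ be the remainder (so $m = q(\frac{n}{2}+1)+r$ with $0 \le r < \frac{n}{2}+1$). Then \[ EBI(K_{m,n}) = \begin{cases} \{ 0,1, \dots, m+n-2q-2 \}, &\text{if } r = 0, \\ \{ 0,1, \dots, m+n-2q-3 \}, &\text{if } r = 1, \\ \{ 0,1, \dots, m+n-2q-4 \}, &\text{if } r \geq 2. \end{cases} \]
   Context: For a graph $G=(V,E)$, a binary edge-labeling is a surjection $f: E \to \{0,1\}$; an edge labeled $i$ is an $i$-edge, and $e(i)$ denotes the number of $i$-edges. The labeling is edge-friendly if $|e(1)-e(0)| \le 1$. For a vertex $v$, $\deg_i(v)$ is the number of $i$-edges incident with $v$. An edge-friendly labeling induces a partial vertex-labeling: $v$ is labeled $1$ if $\deg_1(v) > \deg_0(v)$, labeled $0$ if $\deg_0(v) > \deg_1(v)$, and unlabeled if $\deg_1(v)=\deg_0(v)$. Let $v(i)$ be the number of vertices labeled $i$. The edge-balanced index set is $EBI(G) = \{ |v(1)-v(0)| : f \text{ an edge-friendly labeling of } G\}$. -}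

module Defs where

open import Data.Bool using (Bool; true; false; not; if_then_else_)
open import Data.Nat using (ℕ; zero; suc; _+_; _*_; _≤_; _<ᵇ_; ∣_-_∣)
open import Data.Fin using (Fin)
open import Data.Product using (Σ; ∃; _×_)
open import Relation.Binary.PropositionalEquality using (_≡_)

count : ∀ {k} → (Fin k → Bool) → ℕ
count {zero} p = 0
count {suc k} p = (if p Fin.zero then 1 else 0) + count (λ i → p (Fin.suc i))

sumF : ∀ {k} → (Fin k → ℕ) → ℕ
sumF {zero} g = 0
sumF {suc k} g = g Fin.zero + sumF (λ i → g (Fin.suc i))

-- A binary edge labeling of K_{m,n}: parts A = Fin m, B = Fin n,
-- edge {a,b} labeled f a b (true = 1, false = 0).
Labeling : ℕ → ℕ → Set
Labeling m n = Fin m → Fin n → Bool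

module _ {m n : ℕ} (f : Labeling m n) where
  e1 : ℕ
  e1 = sumF (λ a → count (λ b → f a b))
  e0 : ℕ
  e0 = sumF (λ a → count (λ b → not (f a b)))

  Surjective : Set
  Surjective = (Σ (Fin m) λ a → Σ (Fin n) λ b → f a b ≡ true)
             × (Σ (Fin m) λ a → Σ (Fin n) λ b → f a b ≡ false)

  EdgeFriendly : Set
  EdgeFriendly = ∣ e1 - e0 ∣ ≤ 1

  degA1 degA0 : Fin m → ℕ
  degA1 a = count (λ b → f a b)
  degA0 a = count (λ b → not (f a b))
  degB1 degB0 : Fin n → ℕ
  degB1 b = count (λ a → f a b)
  degB0 b = count (λ a → not (f a b))

  v1 : ℕ
  v1 = count (λ a → degA0 a <ᵇ degA1 a) + count (λ b → degB0 b <ᵇ degB1 b)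
  v0 : ℕ
  v0 = count (λ a → degA1 a <ᵇ degA0 a) + count (λ b → degB1 b <ᵇ degB0 b)

InEBI : ℕ → ℕ → ℕ → Set
InEBI m n k = Σ (Labeling m n) λ f →
  Surjective f × EdgeFriendly f × k ≡ ∣ v1 f - v0 f ∣

-- With m = 2k + 1 and n = 2h, an edge-friendly labeling has exactly m h edges of each label. An A-vertex
-- (degree 2h) labeled 1 has 1-degree at least h + 1 and one labeled 0 at most h - 1 while the unlabeled ones
-- have exactly h, so vA1 ≤ h vA0 and, for the complementary labeling, vA0 ≤ h vA1. A B-vertex (degree 2k + 1)
-- is always labeled, and one labeled 1 has at least k + 1 ones, so (k + 1) vB1 ≤ m h < (k + 1) n and likewise
-- for vB0: both lie between 1 and n - 1. Writing m = q (h + 1) + r, these constraints bound |v(1) - v(0)| by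
-- m + n - 2q - 2 - min(r, 2).
--
-- Conversely, choose the A-degrees among h + 1, 0, h - τ and h with total m h so that vA1 - vA0 is any
-- prescribed j, and lay the rows of ones end to end around the first w columns. For w = n every column gets
-- k or k + 1 ones, so vB1 = vB0 = h; for w = n - 1 the first n - 1 columns get more than k ones and the last
-- none, so vB1 - vB0 = n - 2. Together these reach every value up to the bound.

module Submission where

open import Defs

open import Algebra.Properties.CommutativeMonoid.Sum as Sum using ()
open import Data.Bool using (Bool; true; false; not; if_then_else_; _∧_; _∨_; T)
open import Data.Bool.Properties using (not-involutive; not-injective)
open import Data.Empty using (⊥-elim)
open import Data.Fin using (Fin; toℕ; zero; suc)
open import Data.Fin.Properties using (toℕ<n)
open import Data.List using (List; []; _∷_; _++_; replicate; length; map)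
open import Data.List.Properties using (length-++; length-replicate; map-++; map-replicate; map-id)
open import Data.List.Relation.Unary.All as All using (All)
open import Data.List.Relation.Unary.All.Properties using (++⁺; replicate⁺)
open import Data.Nat using (ℕ; zero; suc; _+_; _*_; _∸_; _≤_; _<_; _/_; _%_; z≤n; s≤s; z<s; _<ᵇ_; ∣_-_∣; >-nonZero)
open import Data.Nat.Divisibility using (_∣_; divides; ∣m∣n⇒∣m+n; ∣-refl)
open import Data.Nat.DivMod using (m<n⇒m%n≡m; [m+kn]%n≡m%n; m%n<n; m≡m%n+[m/n]*n; m*n/n≡m)
open import Data.Nat.ListAction using (sum)
open import Data.Nat.ListAction.Properties using (sum-++)
open import Data.Nat.Properties
open import Algebra.Properties.CommutativeSemigroup +-commutativeSemigroup using (xy∙z≈xz∙y; xy∙z≈x∙zy)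
open import Data.Nat.Tactic.RingSolver using (solve-∀; solve)
open import Data.Product using (Σ; _×_; _,_; proj₁; proj₂)
open import Data.Sum using (_⊎_; inj₁; inj₂; [_,_]′)
open import Data.Unit using (tt)
open import Function.Bundles using (_⇔_; mk⇔)
open import Relation.Binary.Definitions using (tri<; tri≈; tri>)
open import Relation.Binary.PropositionalEquality
  using (_≡_; _≢_; refl; sym; trans; cong; cong₂; subst; subst₂; module ≡-Reasoning)
open import Relation.Nullary using (¬_; yes; no)

-- Counting over Fin

module ∑ = Sum +-0-commutativeMonoid

bit : Bool → ℕ
bit b = if b then 1 else 0

bit-∧ : ∀ a b → bit (a ∧ b) ≡ bit a * bit b
bit-∧ true  b = sym (+-identityʳ (bit b))
bit-∧ false b = refl

<ᵇ≡true⇒< : ∀ {a b} → (a <ᵇ b) ≡ true → a < b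
<ᵇ≡true⇒< {a} {b} e = <ᵇ⇒< a b (subst T (sym e) tt)

<ᵇ≡false⇒≥ : ∀ {a b} → (a <ᵇ b) ≡ false → b ≤ a
<ᵇ≡false⇒≥ e = ≮⇒≥ λ a<b → subst T e (<⇒<ᵇ a<b)

<⇒<ᵇ≡true : ∀ {a b} → a < b → (a <ᵇ b) ≡ true
<⇒<ᵇ≡true {a} {b} a<b with a <ᵇ b in e
... | true  = refl
... | false = ⊥-elim (<⇒≱ a<b (<ᵇ≡false⇒≥ e))

≥⇒<ᵇ≡false : ∀ {a b} → b ≤ a → (a <ᵇ b) ≡ false
≥⇒<ᵇ≡false {a} {b} b≤a with a <ᵇ b in e
... | true  = ⊥-elim (<⇒≱ (<ᵇ≡true⇒< e) b≤a)
... | false = refl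

sumF≡sum : ∀ {k} (g : Fin k → ℕ) → sumF g ≡ ∑.sum g
sumF≡sum {zero}  g = refl
sumF≡sum {suc k} g = cong (g zero +_) (sumF≡sum (λ i → g (suc i)))

sumF-cong : ∀ {k} {g h : Fin k → ℕ} → (∀ i → g i ≡ h i) → sumF g ≡ sumF h
sumF-cong {g = g} {h} g≗h = begin
  sumF g   ≡⟨ sumF≡sum g ⟩
  ∑.sum g  ≡⟨ ∑.sum-cong-≗ g≗h ⟩
  ∑.sum h  ≡⟨ sumF≡sum h ⟨
  sumF h   ∎
  where open ≡-Reasoning

sumF-+ : ∀ {k} (g h : Fin k → ℕ) → sumF (λ i → g i + h i) ≡ sumF g + sumF h
sumF-+ g h = begin
  sumF (λ i → g i + h i)   ≡⟨ sumF≡sum (λ i → g i + h i) ⟩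
  ∑.sum (λ i → g i + h i)  ≡⟨ ∑.∑-distrib-+ g h ⟩
  ∑.sum g + ∑.sum h        ≡⟨ cong₂ _+_ (sumF≡sum g) (sumF≡sum h) ⟨
  sumF g + sumF h          ∎
  where open ≡-Reasoning

sumF-comm : ∀ {m n} (g : Fin m → Fin n → ℕ) →
            sumF (λ a → sumF (λ b → g a b)) ≡ sumF (λ b → sumF (λ a → g a b))
sumF-comm g = begin
  sumF (λ a → sumF (λ b → g a b))    ≡⟨ sumF-cong (λ a → sumF≡sum (g a)) ⟩
  sumF (λ a → ∑.sum (λ b → g a b))   ≡⟨ sumF≡sum (λ a → ∑.sum (g a)) ⟩
  ∑.sum (λ a → ∑.sum (λ b → g a b))  ≡⟨ ∑.∑-comm g ⟩
  ∑.sum (λ b → ∑.sum (λ a → g a b))  ≡⟨ sumF≡sum (λ b → ∑.sum (λ a → g a b)) ⟨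
  sumF (λ b → ∑.sum (λ a → g a b))   ≡⟨ sumF-cong (λ b → sumF≡sum (λ a → g a b)) ⟨
  sumF (λ b → sumF (λ a → g a b))    ∎
  where open ≡-Reasoning

sumF-mono-≤ : ∀ {k} {g h : Fin k → ℕ} → (∀ i → g i ≤ h i) → sumF g ≤ sumF h
sumF-mono-≤ {zero}  g≤h = z≤n
sumF-mono-≤ {suc k} g≤h = +-mono-≤ (g≤h zero) (sumF-mono-≤ (λ i → g≤h (suc i)))

sumF-const : ∀ {k} c → sumF {k} (λ _ → c) ≡ k * c
sumF-const {zero}  c = refl
sumF-const {suc k} c = cong (c +_) (sumF-const {k} c)

sumF-*ˡ : ∀ {k} c (g : Fin k → ℕ) → sumF (λ i → c * g i) ≡ c * sumF g
sumF-*ˡ {zero}  c g = sym (*-zeroʳ c)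
sumF-*ˡ {suc k} c g = trans (cong (c * g zero +_) (sumF-*ˡ c (λ i → g (suc i))))
                            (sym (*-distribˡ-+ c (g zero) _))

sumF-pos⇒∃ : ∀ {k} (g : Fin k → ℕ) → 0 < sumF g → Σ (Fin k) λ i → 0 < g i
sumF-pos⇒∃ {suc k} g pos with g zero in e
... | suc _ = zero , subst (0 <_) (sym e) z<s
... | zero with sumF-pos⇒∃ (λ i → g (suc i)) pos
... | i , gi>0 = suc i , gi>0

count≡sumF-bit : ∀ {k} (p : Fin k → Bool) → count p ≡ sumF (λ i → bit (p i))
count≡sumF-bit {zero}  p = refl
count≡sumF-bit {suc k} p = cong (bit (p zero) +_) (count≡sumF-bit (λ i → p (suc i)))

count-cong : ∀ {k} {p q : Fin k → Bool} → (∀ i → p i ≡ q i) → count p ≡ count q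
count-cong {p = p} {q} p≗q = begin
  count p                  ≡⟨ count≡sumF-bit p ⟩
  sumF (λ i → bit (p i))   ≡⟨ sumF-cong (λ i → cong bit (p≗q i)) ⟩
  sumF (λ i → bit (q i))   ≡⟨ count≡sumF-bit q ⟨
  count q                  ∎
  where open ≡-Reasoning

count-+ : ∀ {k} (p q : Fin k → Bool) → count p + count q ≡ sumF (λ i → bit (p i) + bit (q i))
count-+ p q = trans (cong₂ _+_ (count≡sumF-bit p) (count≡sumF-bit q))
                    (sym (sumF-+ (λ i → bit (p i)) (λ i → bit (q i))))

count-+-cong : ∀ {k} (p q r s : Fin k → Bool) →
               (∀ i → bit (p i) + bit (q i) ≡ bit (r i) + bit (s i)) →
               count p + count q ≡ count r + count s
count-+-cong p q r s eq = trans (count-+ p q) (trans (sumF-cong eq) (sym (count-+ r s)))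

count-disjoint : ∀ {k} (p q : Fin k → Bool) → (∀ i → bit (p i) + bit (q i) ≤ 1) →
                 count p + count q ≤ k
count-disjoint {k} p q disj = begin
  count p + count q                   ≡⟨ count-+ p q ⟩
  sumF (λ i → bit (p i) + bit (q i))  ≤⟨ sumF-mono-≤ disj ⟩
  sumF {k} (λ _ → 1)                  ≡⟨ sumF-const {k} 1 ⟩
  k * 1                               ≡⟨ *-identityʳ k ⟩
  k                                   ∎
  where open ≤-Reasoning

count+count-not : ∀ {k} (p : Fin k → Bool) → count p + count (λ i → not (p i)) ≡ k
count+count-not {zero}  p = refl
count+count-not {suc k} p with p zero
... | true  = cong suc (count+count-not (λ i → p (suc i)))
... | false = trans (+-suc (count (λ i → p (suc i))) _) (cong suc (count+count-not (λ i → p (suc i))))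

count-not : ∀ {k} (p : Fin k → Bool) {a b} → count p ≡ a → a + b ≡ k → count (λ i → not (p i)) ≡ b
count-not p {a} refl ab = +-cancelˡ-≡ a _ _ (trans (count+count-not p) (sym ab))

count-false : ∀ {k} → count {k} (λ _ → false) ≡ 0
count-false {zero}  = refl
count-false {suc k} = count-false {k}

count-toℕ< : ∀ n c → c ≤ n → count {n} (λ i → toℕ i <ᵇ c) ≡ c
count-toℕ< zero    zero    _         = refl
count-toℕ< (suc n) zero    _         = count-false {n}
count-toℕ< (suc n) (suc c) (s≤s c≤n) = cong suc (count-toℕ< n c c≤n)

count-pos⇒∃ : ∀ {k} (p : Fin k → Bool) → 0 < count p → Σ (Fin k) λ i → p i ≡ true
count-pos⇒∃ p pos with sumF-pos⇒∃ (λ i → bit (p i)) (subst (0 <_) (count≡sumF-bit p) pos)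
... | i , pos-i with p i in e
... | true = i , e

double-injective : ∀ a b → a + a ≡ b + b → a ≡ b
double-injective a b eq = *-cancelˡ-≡ a b 2 (begin
  2 * a  ≡⟨ cong (a +_) (+-identityʳ a) ⟩
  a + a  ≡⟨ eq ⟩
  b + b  ≡⟨ cong (b +_) (+-identityʳ b) ⟨
  2 * b  ∎)
  where open ≡-Reasoning

odd≢even : ∀ a b → suc (a + a) ≢ b + b
odd≢even a b eq = even≢odd b a (begin
  2 * b          ≡⟨ cong (b +_) (+-identityʳ b) ⟩
  b + b          ≡⟨ eq ⟨
  suc (a + a)    ≡⟨ cong (λ t → suc (a + t)) (+-identityʳ a) ⟨
  suc (2 * a)    ∎)
  where open ≡-Reasoning

halves-of-≤ : ∀ {a b} E → a ≤ b → a + b ≡ E + E → b ∸ a ≤ 1 → a ≡ E × b ≡ E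
halves-of-≤ {a} {b} E a≤b a+b≡E+E diff with b ∸ a | m+[n∸m]≡n a≤b
... | zero  | b≡a+0 = a≡E , trans (sym b≡a+0) (trans (+-identityʳ a) a≡E)
  where
  a≡E : a ≡ E
  a≡E = double-injective a E (trans (cong (a +_) (trans (sym (+-identityʳ a)) b≡a+0)) a+b≡E+E)
... | suc zero | b≡a+1 = ⊥-elim (odd≢even a E (begin
  suc (a + a)  ≡⟨ +-suc a a ⟨
  a + suc a    ≡⟨ cong (a +_) (+-comm 1 a) ⟩
  a + (a + 1)  ≡⟨ cong (a +_) b≡a+1 ⟩
  a + b        ≡⟨ a+b≡E+E ⟩
  E + E        ∎))
  where open ≡-Reasoning
... | suc (suc _) | _ = ⊥-elim (<⇒≱ (s≤s (s≤s z≤n)) diff)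

halves-of-∣-∣≤1 : ∀ a b E → a + b ≡ E + E → ∣ a - b ∣ ≤ 1 → a ≡ E × b ≡ E
halves-of-∣-∣≤1 a b E a+b≡E+E diff with ≤-total a b
... | inj₁ a≤b = halves-of-≤ E a≤b a+b≡E+E (subst (_≤ 1) (m≤n⇒∣m-n∣≡n∸m a≤b) diff)
... | inj₂ b≤a = let b≡E , a≡E = halves-of-≤ E b≤a (trans (+-comm b a) a+b≡E+E)
                                   (subst (_≤ 1) (m≤n⇒∣n-m∣≡n∸m b≤a) diff)
                 in a≡E , b≡E

-- Vertex labels and the upper bound

-- v1 f = vA1 f + vB1 f and v0 f = vA0 f + vB0 f hold definitionally.
module _ {m n : ℕ} (f : Labeling m n) where
  vA1 vA0 vB1 vB0 : ℕ
  vA1 = count (λ a → degA0 f a <ᵇ degA1 f a)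
  vA0 = count (λ a → degA1 f a <ᵇ degA0 f a)
  vB1 = count (λ b → degB0 f b <ᵇ degB1 f b)
  vB0 = count (λ b → degB1 f b <ᵇ degB0 f b)

  complement : Labeling m n
  complement a b = not (f a b)

  degA1+degA0 : ∀ a → degA1 f a + degA0 f a ≡ n
  degA1+degA0 a = count+count-not (f a)

  degB1+degB0 : ∀ b → degB1 f b + degB0 f b ≡ m
  degB1+degB0 b = count+count-not (λ a → f a b)

  e1+e0 : e1 f + e0 f ≡ m * n
  e1+e0 = begin
    e1 f + e0 f                          ≡⟨ sumF-+ (degA1 f) (degA0 f) ⟨
    sumF (λ a → degA1 f a + degA0 f a)   ≡⟨ sumF-cong degA1+degA0 ⟩
    sumF {m} (λ _ → n)                   ≡⟨ sumF-const {m} n ⟩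
    m * n                                ∎
    where open ≡-Reasoning

  sumF-degB1 : sumF (degB1 f) ≡ e1 f
  sumF-degB1 = begin
    sumF (degB1 f)                             ≡⟨ sumF-cong (λ b → count≡sumF-bit (λ a → f a b)) ⟩
    sumF (λ b → sumF (λ a → bit (f a b)))      ≡⟨ sumF-comm (λ a b → bit (f a b)) ⟨
    sumF (λ a → sumF (λ b → bit (f a b)))      ≡⟨ sumF-cong (λ a → count≡sumF-bit (f a)) ⟨
    e1 f                                       ∎
    where open ≡-Reasoning

<ᵇ-exclusive : ∀ a b → bit (a <ᵇ b) + bit (b <ᵇ a) ≤ 1
<ᵇ-exclusive a b with <-cmp a b
... | tri< a<b _ _ rewrite <⇒<ᵇ≡true a<b | ≥⇒<ᵇ≡false (<⇒≤ a<b) = ≤-refl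
... | tri≈ _ refl _ rewrite ≥⇒<ᵇ≡false (≤-refl {a}) = z≤n
... | tri> _ _ b<a rewrite ≥⇒<ᵇ≡false (<⇒≤ b<a) | <⇒<ᵇ≡true b<a = ≤-refl

module _ {m n : ℕ} (f : Labeling m n) where
  private
    g : Labeling m n
    g = complement f

  vA1+vA0≤m : vA1 f + vA0 f ≤ m
  vA1+vA0≤m = count-disjoint _ _ (λ a → <ᵇ-exclusive (degA0 f a) (degA1 f a))

  complement-vA1 : vA1 g ≡ vA0 f
  complement-vA1 = count-cong (λ a → cong (_<ᵇ degA0 f a) (count-cong (λ b → not-involutive (f a b))))

  complement-vA0 : vA0 g ≡ vA1 f
  complement-vA0 = count-cong (λ a → cong (degA0 f a <ᵇ_) (count-cong (λ b → not-involutive (f a b))))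

  complement-vB1 : vB1 g ≡ vB0 f
  complement-vB1 = count-cong (λ b → cong (_<ᵇ degB0 f b) (count-cong (λ a → not-involutive (f a b))))

<ᵇ-cong-⇔ : ∀ a b c d → (a < b → c < d) → (c < d → a < b) → (a <ᵇ b) ≡ (c <ᵇ d)
<ᵇ-cong-⇔ a b c d to from with c <ᵇ d in c<ᵇd
... | true  = <⇒<ᵇ≡true (from (<ᵇ≡true⇒< c<ᵇd))
... | false = ≥⇒<ᵇ≡false (≮⇒≥ λ a<b → <⇒≱ (to a<b) (<ᵇ≡false⇒≥ c<ᵇd))

h≤h+h∸e : ∀ {h e} → e ≤ h → h ≤ h + h ∸ e
h≤h+h∸e {h} e≤h = ≤-trans (≤-reflexive (sym (m+n∸n≡m h h))) (∸-monoʳ-≤ (h + h) e≤h)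

h+h∸e≤h : ∀ {h e} → h ≤ e → h + h ∸ e ≤ h
h+h∸e≤h {h} h≤e = ≤-trans (∸-monoʳ-≤ (h + h) h≤e) (≤-reflexive (m+n∸n≡m h h))

even-majority : ∀ h e → ((h + h ∸ e) <ᵇ e) ≡ (h <ᵇ e)
even-majority h e = <ᵇ-cong-⇔ (h + h ∸ e) e h e
  (λ lt → ≰⇒> λ e≤h → <⇒≱ lt (≤-trans e≤h (h≤h+h∸e e≤h)))
  (λ h<e → ≤-<-trans (h+h∸e≤h (<⇒≤ h<e)) h<e)

even-minority : ∀ h e → (e <ᵇ (h + h ∸ e)) ≡ (e <ᵇ h)
even-minority h e = <ᵇ-cong-⇔ e (h + h ∸ e) e h
  (λ lt → ≰⇒> λ h≤e → <⇒≱ lt (≤-trans (h+h∸e≤h h≤e) h≤e))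
  (λ e<h → <-≤-trans e<h (h≤h+h∸e (<⇒≤ e<h)))

odd∸half : ∀ k → suc (k + k) ∸ k ≡ suc k
odd∸half k = trans (+-∸-assoc 1 (m≤m+n k k)) (cong suc (m+n∸n≡m k k))

odd∸≤half : ∀ {k c} → k < c → suc (k + k) ∸ c ≤ k
odd∸≤half {k} k<c = ≤-trans (∸-monoʳ-≤ (suc (k + k)) k<c) (h+h∸e≤h ≤-refl)

odd∸>half : ∀ {k c} → c ≤ k → k < suc (k + k) ∸ c
odd∸>half {k} c≤k = <-≤-trans (subst (k <_) (sym (odd∸half k)) (n<1+n k)) (∸-monoʳ-≤ (suc (k + k)) c≤k)

odd-majority : ∀ k c → ((suc (k + k) ∸ c) <ᵇ c) ≡ (k <ᵇ c)
odd-majority k c = <ᵇ-cong-⇔ (suc (k + k) ∸ c) c k c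
  (λ lt → ≰⇒> λ c≤k → <-asym lt (≤-<-trans c≤k (odd∸>half c≤k)))
  (λ k<c → ≤-<-trans (odd∸≤half k<c) k<c)

odd-minority : ∀ k c → (c <ᵇ (suc (k + k) ∸ c)) ≡ (c <ᵇ suc k)
odd-minority k c = <ᵇ-cong-⇔ c (suc (k + k) ∸ c) c (suc k)
  (λ lt → ≰⇒> λ k<c → <-asym lt (≤-<-trans (odd∸≤half k<c) k<c))
  (λ c≤k → ≤-<-trans (≤-pred c≤k) (odd∸>half (≤-pred c≤k)))

module _ {m h : ℕ} (f : Labeling m (h + h)) where
  degA0≡ : ∀ a → degA0 f a ≡ h + h ∸ degA1 f a
  degA0≡ a = sym (trans (cong (_∸ degA1 f a) (sym (degA1+degA0 f a))) (m+n∸m≡n (degA1 f a) (degA0 f a)))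

  vA1≡count : vA1 f ≡ count (λ a → h <ᵇ degA1 f a)
  vA1≡count = count-cong λ a → trans (cong (_<ᵇ degA1 f a) (degA0≡ a)) (even-majority h (degA1 f a))

  vA0≡count : vA0 f ≡ count (λ a → degA1 f a <ᵇ h)
  vA0≡count = count-cong λ a → trans (cong (degA1 f a <ᵇ_) (degA0≡ a)) (even-minority h (degA1 f a))

module _ {k n : ℕ} (f : Labeling (suc (k + k)) n) where
  degB0≡ : ∀ b → degB0 f b ≡ suc (k + k) ∸ degB1 f b
  degB0≡ b = sym (trans (cong (_∸ degB1 f b) (sym (degB1+degB0 f b))) (m+n∸m≡n (degB1 f b) (degB0 f b)))

  vB1≡count : vB1 f ≡ count (λ b → k <ᵇ degB1 f b)
  vB1≡count = count-cong λ b → trans (cong (_<ᵇ degB1 f b) (degB0≡ b)) (odd-majority k (degB1 f b))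

  vB0≡count : vB0 f ≡ count (λ b → degB1 f b <ᵇ suc k)
  vB0≡count = count-cong λ b → trans (cong (degB1 f b <ᵇ_) (degB0≡ b)) (odd-minority k (degB1 f b))

row-weight-≤ : ∀ h d → h + bit (h <ᵇ d) ≤ d + h * bit (d <ᵇ h)
row-weight-≤ h d with <-cmp h d
... | tri< h<d _ _ rewrite <⇒<ᵇ≡true h<d | ≥⇒<ᵇ≡false (<⇒≤ h<d) | *-zeroʳ h | +-identityʳ d =
  subst (_≤ d) (+-comm 1 h) h<d
... | tri≈ _ refl _ rewrite ≥⇒<ᵇ≡false (≤-refl {h}) | *-zeroʳ h = ≤-refl
... | tri> _ _ d<h rewrite ≥⇒<ᵇ≡false (<⇒≤ d<h) | <⇒<ᵇ≡true d<h | *-identityʳ h | +-identityʳ h =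
  m≤n+m h d

column-weight-≤ : ∀ k c → suc k * bit (k <ᵇ c) ≤ c
column-weight-≤ k c with k <ᵇ c in k<ᵇc
... | false = subst (_≤ c) (sym (*-zeroʳ (suc k))) z≤n
... | true  = subst (_≤ c) (sym (*-identityʳ (suc k))) (<ᵇ≡true⇒< k<ᵇc)

<ᵇ-or-<ᵇsuc : ∀ k c → bit (k <ᵇ c) + bit (c <ᵇ suc k) ≡ 1
<ᵇ-or-<ᵇsuc k c with ≤-<-connex c k
... | inj₁ c≤k rewrite ≥⇒<ᵇ≡false c≤k | <⇒<ᵇ≡true (s≤s c≤k) = refl
... | inj₂ k<c rewrite <⇒<ᵇ≡true k<c | ≥⇒<ᵇ≡false k<c = refl

module _ {m h : ℕ} (f : Labeling m (h + h)) where
  weighted-vA-≤ : m * h + vA1 f ≤ e1 f + h * vA0 f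
  weighted-vA-≤ = begin
    m * h + vA1 f
      ≡⟨ cong₂ _+_ (sym (sumF-const {m} h)) (trans (vA1≡count {h = h} f) (count≡sumF-bit (λ a → h <ᵇ degA1 f a))) ⟩
    sumF {m} (λ _ → h) + sumF (λ a → bit (h <ᵇ degA1 f a))
      ≡⟨ sumF-+ (λ _ → h) (λ a → bit (h <ᵇ degA1 f a)) ⟨
    sumF (λ a → h + bit (h <ᵇ degA1 f a))
      ≤⟨ sumF-mono-≤ (λ a → row-weight-≤ h (degA1 f a)) ⟩
    sumF (λ a → degA1 f a + h * bit (degA1 f a <ᵇ h))
      ≡⟨ sumF-+ (degA1 f) (λ a → h * bit (degA1 f a <ᵇ h)) ⟩
    e1 f + sumF (λ a → h * bit (degA1 f a <ᵇ h))
      ≡⟨ cong (e1 f +_) (sumF-*ˡ h (λ a → bit (degA1 f a <ᵇ h))) ⟩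
    e1 f + h * sumF (λ a → bit (degA1 f a <ᵇ h))
      ≡⟨ cong (λ t → e1 f + h * t) (trans (vA0≡count {h = h} f) (count≡sumF-bit (λ a → degA1 f a <ᵇ h))) ⟨
    e1 f + h * vA0 f
      ∎
    where open ≤-Reasoning

  friendly⇒e1≡e0≡m*h : EdgeFriendly f → e1 f ≡ m * h × e0 f ≡ m * h
  friendly⇒e1≡e0≡m*h = halves-of-∣-∣≤1 (e1 f) (e0 f) (m * h) (trans (e1+e0 f) (*-distribˡ-+ m h h))

module _ {k n : ℕ} (f : Labeling (suc (k + k)) n) where
  weighted-vB1-≤ : suc k * vB1 f ≤ e1 f
  weighted-vB1-≤ = begin
    suc k * vB1 f
      ≡⟨ cong (suc k *_) (trans (vB1≡count {k = k} f) (count≡sumF-bit (λ b → k <ᵇ degB1 f b))) ⟩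
    suc k * sumF (λ b → bit (k <ᵇ degB1 f b))
      ≡⟨ sumF-*ˡ (suc k) (λ b → bit (k <ᵇ degB1 f b)) ⟨
    sumF (λ b → suc k * bit (k <ᵇ degB1 f b))
      ≤⟨ sumF-mono-≤ (λ b → column-weight-≤ k (degB1 f b)) ⟩
    sumF (degB1 f)
      ≡⟨ sumF-degB1 f ⟩
    e1 f
      ∎
    where open ≤-Reasoning

  vB1+vB0≡n : vB1 f + vB0 f ≡ n
  vB1+vB0≡n = begin
    vB1 f + vB0 f
      ≡⟨ cong₂ _+_ (vB1≡count {k = k} f) (vB0≡count {k = k} f) ⟩
    count (λ b → k <ᵇ degB1 f b) + count (λ b → degB1 f b <ᵇ suc k)
      ≡⟨ count-+ (λ b → k <ᵇ degB1 f b) (λ b → degB1 f b <ᵇ suc k) ⟩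
    sumF (λ b → bit (k <ᵇ degB1 f b) + bit (degB1 f b <ᵇ suc k))
      ≡⟨ sumF-cong (λ b → <ᵇ-or-<ᵇsuc k (degB1 f b)) ⟩
    sumF {n} (λ _ → 1)
      ≡⟨ trans (sumF-const {n} 1) (*-identityʳ n) ⟩
    n
      ∎
    where open ≡-Reasoning

-- If y > q then x + y ≤ m already gives the bound; otherwise x - y ≤ (h - 1) y ≤ (h - 1) q.
imbalance-≤ : ∀ {x y h q r c m} → 1 ≤ h → x ≤ h * y → x + y ≤ m → m ≡ q * suc h + r →
              c ≤ r → c ≤ 2 → x + (2 * q + c) ≤ y + m
imbalance-≤ {x} {y} {suc h} {q} {r} {c} {m} _ x≤hy x+y≤m refl c≤r c≤2 with <-≤-connex q y
... | inj₁ q<y = begin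
  x + (2 * q + c)  ≤⟨ +-monoʳ-≤ x (+-monoʳ-≤ (2 * q) c≤2) ⟩
  x + (2 * q + 2)  ≡⟨ cong (x +_) (solve (q ∷ [])) ⟩
  x + 2 * suc q    ≤⟨ +-monoʳ-≤ x (*-monoʳ-≤ 2 q<y) ⟩
  x + 2 * y        ≡⟨ solve (x ∷ y ∷ []) ⟩
  (x + y) + y      ≤⟨ +-monoˡ-≤ y x+y≤m ⟩
  m + y            ≡⟨ +-comm m y ⟩
  y + m            ∎
  where open ≤-Reasoning
... | inj₂ y≤q = begin
  x + (2 * q + c)              ≤⟨ +-mono-≤ x≤hy (+-monoʳ-≤ (2 * q) c≤r) ⟩
  suc h * y + (2 * q + r)      ≡⟨ solve (h ∷ y ∷ q ∷ r ∷ []) ⟩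
  y + (h * y + 2 * q + r)      ≤⟨ +-monoʳ-≤ y (+-monoˡ-≤ r (+-monoˡ-≤ (2 * q) (*-monoʳ-≤ h y≤q))) ⟩
  y + (h * q + 2 * q + r)      ≡⟨ cong (y +_) (solve (h ∷ q ∷ r ∷ [])) ⟩
  y + (q * suc (suc h) + r)    ∎
  where open ≤-Reasoning

∣-∣≤∸ : ∀ {a b K M} → a + K ≤ b + M → b + K ≤ a + M → ∣ a - b ∣ ≤ M ∸ K
∣-∣≤∸ {a} {b} {K} {M} a+K≤b+M b+K≤a+M =
  [ (λ a≤b → ordered a≤b b+K≤a+M)
  , (λ b≤a → subst (_≤ M ∸ K) (∣-∣-comm b a) (ordered b≤a a+K≤b+M)) ]′ (≤-total a b)
  where
  ordered : ∀ {a b} → a ≤ b → b + K ≤ a + M → ∣ a - b ∣ ≤ M ∸ K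
  ordered {a} {b} a≤b b+K≤a+M = subst (_≤ M ∸ K) (sym (m≤n⇒∣m-n∣≡n∸m a≤b))
    (m+n≤o⇒m≤o∸n (b ∸ a) (+-cancelˡ-≤ a _ _ (begin
      a + (b ∸ a + K)  ≡⟨ +-assoc a (b ∸ a) K ⟨
      a + (b ∸ a) + K  ≡⟨ cong (_+ K) (m+[n∸m]≡n a≤b) ⟩
      b + K            ≤⟨ b+K≤a+M ⟩
      a + M            ∎)))
    where open ≤-Reasoning

<⇒summand-pos : ∀ {s t n} → s + t ≡ n → s < n → 0 < t
<⇒summand-pos {s} {zero}  refl s<n = ⊥-elim (<⇒≢ s<n (sym (+-identityʳ s)))
<⇒summand-pos {s} {suc t} _    _   = z<s

module UpperBound {k h : ℕ} (f : Labeling (suc (k + k)) (h + h)) (h≥1 : 1 ≤ h) (friendly : EdgeFriendly f) where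
  private
    m n : ℕ
    m = suc (k + k)
    n = h + h
    g : Labeling m n
    g = complement f
    e1≡m*h : e1 f ≡ m * h
    e1≡m*h = proj₁ (friendly⇒e1≡e0≡m*h {h = h} f friendly)
    e0≡m*h : e0 f ≡ m * h
    e0≡m*h = proj₂ (friendly⇒e1≡e0≡m*h {h = h} f friendly)

  vA1≤h*vA0 : vA1 f ≤ h * vA0 f
  vA1≤h*vA0 = +-cancelˡ-≤ (m * h) _ _ (subst (λ e → m * h + vA1 f ≤ e + h * vA0 f) e1≡m*h (weighted-vA-≤ {h = h} f))

  vA0≤h*vA1 : vA0 f ≤ h * vA1 f
  vA0≤h*vA1 = +-cancelˡ-≤ (m * h) _ _ (subst₂ (λ e y → m * h + vA0 f ≤ e + h * y) e0≡m*h (complement-vA0 f)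
    (subst (λ x → m * h + x ≤ e1 g + h * vA0 g) (complement-vA1 f) (weighted-vA-≤ {h = h} g)))

  weighted-vB-bound : ∀ s → suc k * s ≤ m * h → s < n
  weighted-vB-bound s ks≤mh = *-cancelˡ-< (suc k) s n (begin-strict
    suc k * s            ≤⟨ ks≤mh ⟩
    m * h                <⟨ m<m+n (m * h) h≥1 ⟩
    suc (k + k) * h + h  ≡⟨ solve (k ∷ h ∷ []) ⟩
    suc k * (h + h)      ∎)
    where open ≤-Reasoning

  vB1<n : vB1 f < n
  vB1<n = weighted-vB-bound (vB1 f) (subst (suc k * vB1 f ≤_) e1≡m*h (weighted-vB1-≤ {k = k} f))

  vB0<n : vB0 f < n
  vB0<n = weighted-vB-bound (vB0 f)
    (subst₂ (λ s e → suc k * s ≤ e) (complement-vB1 f) e0≡m*h (weighted-vB1-≤ {k = k} g))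

  vB0≥1 : 1 ≤ vB0 f
  vB0≥1 = <⇒summand-pos (vB1+vB0≡n {k = k} f) vB1<n

  vB1≥1 : 1 ≤ vB1 f
  vB1≥1 = <⇒summand-pos (trans (+-comm (vB0 f) (vB1 f)) (vB1+vB0≡n {k = k} f)) vB0<n

  ebi-≤ : ∀ {q r c} → m ≡ q * suc h + r → c ≤ r → c ≤ 2 → ∣ v1 f - v0 f ∣ ≤ m + n ∸ 2 * q ∸ (c + 2)
  ebi-≤ {q} {r} {c} m≡ c≤r c≤2 = subst (∣ v1 f - v0 f ∣ ≤_) (sym (∸-+-assoc (m + n) (2 * q) (c + 2)))
    (∣-∣≤∸ {v1 f} {v0 f} {2 * q + (c + 2)} {m + n} (one-side vA1≤h*vA0 (vA1+vA0≤m f) vB0≥1 (vB1+vB0≡n {k = k} f))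
           (one-side vA0≤h*vA1 (subst (_≤ m) (+-comm (vA1 f) (vA0 f)) (vA1+vA0≤m f)) vB1≥1
                     (trans (+-comm (vB0 f) (vB1 f)) (vB1+vB0≡n {k = k} f))))
    where
    one-side : ∀ {x y s t} → x ≤ h * y → x + y ≤ m → 1 ≤ t → s + t ≡ n →
               x + s + (2 * q + (c + 2)) ≤ y + t + (m + n)
    one-side {x} {y} {s} {t} x≤hy x+y≤m t≥1 s+t≡n = begin
      x + s + (2 * q + (c + 2))     ≡⟨ solve (x ∷ s ∷ q ∷ c ∷ []) ⟩
      (x + (2 * q + c)) + (s + 2)   ≤⟨ +-mono-≤ (imbalance-≤ {x} {y} {h} {q} {r} {c} {m} h≥1 x≤hy x+y≤m m≡ c≤r c≤2) (+-monoʳ-≤ s (+-mono-≤ t≥1 t≥1)) ⟩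
      (y + m) + (s + (t + t))       ≡⟨ cong ((y + m) +_) (+-assoc s t t) ⟨
      (y + m) + (s + t + t)         ≡⟨ cong (λ u → (y + m) + (u + t)) s+t≡n ⟩
      (y + suc (k + k)) + ((h + h) + t)  ≡⟨ solve (y ∷ t ∷ k ∷ h ∷ []) ⟩
      y + t + (suc (k + k) + (h + h))    ∎
      where open ≤-Reasoning

  ebi≡0 : h ≡ 1 → ∣ v1 f - v0 f ∣ ≡ 0
  ebi≡0 refl = m≡n⇒∣m-n∣≡0 (cong₂ _+_ vA1≡vA0 vB1≡vB0)
    where
    vA1≡vA0 : vA1 f ≡ vA0 f
    vA1≡vA0 = ≤-antisym (subst (vA1 f ≤_) (*-identityˡ _) vA1≤h*vA0) (subst (vA0 f ≤_) (*-identityˡ _) vA0≤h*vA1)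
    vB1≡vB0 : vB1 f ≡ vB0 f
    vB1≡vB0 = ≤-antisym (≤-trans (≤-pred vB1<n) vB0≥1) (≤-trans (≤-pred vB0<n) vB1≥1)

module _ {m h : ℕ} (f : Labeling m (h + h)) where
  friendly-surjective : e1 f ≡ m * h → 0 < m * h → Surjective f × EdgeFriendly f
  friendly-surjective e1≡m*h mh>0 = (has-edge f e1≡m*h , has-0-edge) , friendly
    where
    e0≡m*h : e0 f ≡ m * h
    e0≡m*h = +-cancelˡ-≡ (m * h) _ _ (begin
      m * h + e0 f  ≡⟨ cong (_+ e0 f) e1≡m*h ⟨
      e1 f + e0 f   ≡⟨ e1+e0 f ⟩
      m * (h + h)   ≡⟨ *-distribˡ-+ m h h ⟩
      m * h + m * h ∎)
      where open ≡-Reasoning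

    friendly : EdgeFriendly f
    friendly = subst (_≤ 1) (sym (trans (cong₂ ∣_-_∣ e1≡m*h e0≡m*h) (∣n-n∣≡0 (m * h)))) z≤n

    has-edge : ∀ g → e1 g ≡ m * h → Σ (Fin m) λ a → Σ (Fin (h + h)) λ b → g a b ≡ true
    has-edge g e1≡ with sumF-pos⇒∃ (degA1 g) (subst (0 <_) (sym e1≡) mh>0)
    ... | a , degA1>0 with count-pos⇒∃ (g a) degA1>0
    ... | b , gab = a , b , gab

    has-0-edge : Σ (Fin m) λ a → Σ (Fin (h + h)) λ b → f a b ≡ false
    has-0-edge with has-edge (complement f) e0≡m*h
    ... | a , b , ¬fab = a , b , not-injective ¬fab

-- Cyclic fillings

Row : Set
Row = ℕ → Bool

-- The columns P, P + 1, …, P + e - 1 read cyclically modulo w, for P < w and e ≤ w.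
arc : (w P e : ℕ) → Row
arc w P e β = if P + e <ᵇ w then (β <ᵇ P + e) ∧ not (β <ᵇ P)
              else (β <ᵇ w) ∧ (not (β <ᵇ P) ∨ (β <ᵇ P + e ∸ w))

wraps : (w P e : ℕ) → Bool
wraps w P e = not (P + e <ᵇ w)

arcEnd : (w P e : ℕ) → ℕ
arcEnd w P e = if P + e <ᵇ w then P + e else P + e ∸ w

-- Rows of the given lengths laid end to end around a cylinder of circumference w, starting at column P.
arcs : (w P : ℕ) → List ℕ → List Row
arcs w P []      = []
arcs w P (e ∷ L) = arc w P e ∷ arcs w (arcEnd w P e) L

laps : (w P : ℕ) → List ℕ → ℕ
laps w P []      = 0
laps w P (e ∷ L) = bit (wraps w P e) + laps w (arcEnd w P e) L

arcsEnd : (w P : ℕ) → List ℕ → ℕ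
arcsEnd w P []      = P
arcsEnd w P (e ∷ L) = arcsEnd w (arcEnd w P e) L

module _ {w P e : ℕ} (P<w : P < w) (e≤w : e ≤ w) where
  wrapped-< : P + e ∸ w < w
  wrapped-< = m<n+o⇒m∸n<o (P + e) w {{>-nonZero (≤-<-trans z≤n P<w)}} (+-mono-<-≤ P<w e≤w)

  wrapped-≤ : P + e ∸ w ≤ P
  wrapped-≤ = ≤-trans (∸-monoˡ-≤ w (+-monoʳ-≤ P e≤w)) (≤-reflexive (m+n∸n≡m P w))

  arc-step : bit (wraps w P e) * w + arcEnd w P e ≡ P + e × arcEnd w P e < w
  arc-step with P + e <ᵇ w in P+e<ᵇw
  ... | true  = refl , <ᵇ≡true⇒< P+e<ᵇw
  ... | false = trans (cong (_+ (P + e ∸ w)) (+-identityʳ w)) (m+[n∸m]≡n (<ᵇ≡false⇒≥ {P + e} {w} P+e<ᵇw)) , wrapped-<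

  -- Adding the prefix of columns before the start of an arc gives the prefix before its end, plus one lap if it wraps.
  arc-indicator : ∀ β → bit (arc w P e β) + bit (β <ᵇ P) ≡ bit (wraps w P e ∧ (β <ᵇ w)) + bit (β <ᵇ arcEnd w P e)
  arc-indicator β with P + e <ᵇ w
  arc-indicator β | true with β <ᵇ P in β<ᵇP | β <ᵇ P + e in β<ᵇP+e
  ... | true  | true  = refl
  ... | true  | false = ⊥-elim (<⇒≱ (<ᵇ≡true⇒< β<ᵇP) (≤-trans (m≤m+n P e) (<ᵇ≡false⇒≥ β<ᵇP+e)))
  ... | false | true  = refl
  ... | false | false = refl
  arc-indicator β | false with β <ᵇ w in β<ᵇw | β <ᵇ P in β<ᵇP | β <ᵇ P + e ∸ w in β<ᵇend
  ... | false | false | false = refl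
  ... | false | true  | _     = ⊥-elim (<⇒≱ (<-trans (<ᵇ≡true⇒< β<ᵇP) P<w) (<ᵇ≡false⇒≥ β<ᵇw))
  ... | false | false | true  = ⊥-elim (<⇒≱ (<-trans (<ᵇ≡true⇒< β<ᵇend) wrapped-<) (<ᵇ≡false⇒≥ β<ᵇw))
  ... | true  | true  | true  = refl
  ... | true  | true  | false = refl
  ... | true  | false | true  = ⊥-elim (<⇒≱ (<-≤-trans (<ᵇ≡true⇒< β<ᵇend) wrapped-≤) (<ᵇ≡false⇒≥ β<ᵇP))
  ... | true  | false | false = refl

count-∧-toℕ< : ∀ n w b → w ≤ n → count {n} (λ i → b ∧ (toℕ i <ᵇ w)) ≡ bit b * w
count-∧-toℕ< n w true  w≤n = trans (count-toℕ< n w w≤n) (sym (+-identityʳ w))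
count-∧-toℕ< n w false w≤n = count-false {n}

count-arc : ∀ {n w P e} → w ≤ n → P < w → e ≤ w → count {n} (λ b → arc w P e (toℕ b)) ≡ e
count-arc {n} {w} {P} {e} w≤n P<w e≤w = +-cancelʳ-≡ P (count {n} (λ b → arc w P e (toℕ b))) e (begin
  count {n} (λ b → arc w P e (toℕ b)) + P
    ≡⟨ cong (count {n} (λ b → arc w P e (toℕ b)) +_) (count-toℕ< n P (≤-trans (<⇒≤ P<w) w≤n)) ⟨
  count {n} (λ b → arc w P e (toℕ b)) + count {n} (λ b → toℕ b <ᵇ P)
    ≡⟨ count-+-cong {n} (λ b → arc w P e (toℕ b)) (λ b → toℕ b <ᵇ P) (λ b → wraps w P e ∧ (toℕ b <ᵇ w)) (λ b → toℕ b <ᵇ arcEnd w P e)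
                    (λ b → arc-indicator P<w e≤w (toℕ b)) ⟩
  count {n} (λ b → wraps w P e ∧ (toℕ b <ᵇ w)) + count {n} (λ b → toℕ b <ᵇ arcEnd w P e)
    ≡⟨ cong₂ _+_ (count-∧-toℕ< n w (wraps w P e) w≤n)
                 (count-toℕ< n (arcEnd w P e) (≤-trans (<⇒≤ (proj₂ (arc-step P<w e≤w))) w≤n)) ⟩
  bit (wraps w P e) * w + arcEnd w P e
    ≡⟨ proj₁ (arc-step P<w e≤w) ⟩
  P + e
    ≡⟨ +-comm P e ⟩
  e + P
    ∎)
  where open ≡-Reasoning

module _ {w : ℕ} where
  column-arcs : ∀ {P} L → P < w → All (_≤ w) L → ∀ β →
    sum (map (λ r → bit (r β)) (arcs w P L)) + bit (β <ᵇ P) ≡ laps w P L * bit (β <ᵇ w) + bit (β <ᵇ arcsEnd w P L)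
  column-arcs [] P<w _ β = refl
  column-arcs {P} (e ∷ L) P<w (e≤w All.∷ L≤w) β = begin
    bit (arc w P e β) + C + bit (β <ᵇ P)
      ≡⟨ xy∙z≈xz∙y (bit (arc w P e β)) C (bit (β <ᵇ P)) ⟩
    (bit (arc w P e β) + bit (β <ᵇ P)) + C
      ≡⟨ cong (_+ C) (arc-indicator P<w e≤w β) ⟩
    (bit (wraps w P e ∧ (β <ᵇ w)) + bit (β <ᵇ P′)) + C
      ≡⟨ cong (λ t → t + bit (β <ᵇ P′) + C) (bit-∧ (wraps w P e) (β <ᵇ w)) ⟩
    (bit (wraps w P e) * W + bit (β <ᵇ P′)) + C
      ≡⟨ xy∙z≈x∙zy (bit (wraps w P e) * W) (bit (β <ᵇ P′)) C ⟩
    bit (wraps w P e) * W + (C + bit (β <ᵇ P′))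
      ≡⟨ cong (bit (wraps w P e) * W +_) (column-arcs L (proj₂ (arc-step P<w e≤w)) L≤w β) ⟩
    bit (wraps w P e) * W + (laps w P′ L * W + bit (β <ᵇ arcsEnd w P′ L))
      ≡⟨ +-assoc (bit (wraps w P e) * W) (laps w P′ L * W) _ ⟨
    (bit (wraps w P e) * W + laps w P′ L * W) + bit (β <ᵇ arcsEnd w P′ L)
      ≡⟨ cong (_+ bit (β <ᵇ arcsEnd w P′ L)) (*-distribʳ-+ W (bit (wraps w P e)) (laps w P′ L)) ⟨
    (bit (wraps w P e) + laps w P′ L) * W + bit (β <ᵇ arcsEnd w P′ L)
      ∎
    where
    open ≡-Reasoning
    P′ = arcEnd w P e
    C = sum (map (λ r → bit (r β)) (arcs w P′ L))
    W = bit (β <ᵇ w)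

  laps*w+arcsEnd : ∀ {P} L → P < w → All (_≤ w) L → laps w P L * w + arcsEnd w P L ≡ P + sum L × arcsEnd w P L < w
  laps*w+arcsEnd {P} [] P<w _ = sym (+-identityʳ P) , P<w
  laps*w+arcsEnd {P} (e ∷ L) P<w (e≤w All.∷ L≤w) = (begin
    (bit (wraps w P e) + laps w P′ L) * w + arcsEnd w P′ L
      ≡⟨ cong (_+ arcsEnd w P′ L) (*-distribʳ-+ w (bit (wraps w P e)) (laps w P′ L)) ⟩
    (bit (wraps w P e) * w + laps w P′ L * w) + arcsEnd w P′ L
      ≡⟨ +-assoc (bit (wraps w P e) * w) (laps w P′ L * w) (arcsEnd w P′ L) ⟩
    bit (wraps w P e) * w + (laps w P′ L * w + arcsEnd w P′ L)
      ≡⟨ cong (bit (wraps w P e) * w +_) (proj₁ rest) ⟩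
    bit (wraps w P e) * w + (P′ + sum L)
      ≡⟨ +-assoc (bit (wraps w P e) * w) P′ (sum L) ⟨
    bit (wraps w P e) * w + P′ + sum L
      ≡⟨ cong (_+ sum L) (proj₁ (arc-step P<w e≤w)) ⟩
    P + e + sum L
      ≡⟨ +-assoc P e (sum L) ⟩
    P + (e + sum L)
      ∎) , proj₂ rest
    where
    open ≡-Reasoning
    P′ = arcEnd w P e
    rest = laps*w+arcsEnd L (proj₂ (arc-step P<w e≤w)) L≤w

  sum-count-arcs : ∀ {n P} L → w ≤ n → P < w → All (_≤ w) L → (G : ℕ → ℕ) →
    sum (map (λ r → G (count {n} (λ b → r (toℕ b)))) (arcs w P L)) ≡ sum (map G L)
  sum-count-arcs [] w≤n P<w _ G = refl
  sum-count-arcs (e ∷ L) w≤n P<w (e≤w All.∷ L≤w) G =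
    cong₂ _+_ (cong G (count-arc w≤n P<w e≤w)) (sum-count-arcs L w≤n (proj₂ (arc-step P<w e≤w)) L≤w G)

  length-arcs : ∀ P L → length (arcs w P L) ≡ length L
  length-arcs P []      = refl
  length-arcs P (e ∷ L) = cong suc (length-arcs (arcEnd w P e) L)

rowAt : List Row → ℕ → Row
rowAt []      _       _ = false
rowAt (r ∷ R) zero      = r
rowAt (r ∷ R) (suc i)   = rowAt R i

sumF-rowAt : ∀ {m} R → length R ≡ m → (G : Row → ℕ) → sumF {m} (λ a → G (rowAt R (toℕ a))) ≡ sum (map G R)
sumF-rowAt {zero}  []      _   G = refl
sumF-rowAt {suc m} (r ∷ R) len G = cong (G r +_) (sumF-rowAt R (suc-injective len) G)

cyclic : ∀ {m n} (w : ℕ) → List ℕ → Labeling m n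
cyclic w L a b = rowAt (arcs w 0 L) (toℕ a) (toℕ b)

module Cyclic {m n w : ℕ} (L : List ℕ) (length≡m : length L ≡ m) (w≤n : w ≤ n) (w>0 : 0 < w) (L≤w : All (_≤ w) L) where
  f : Labeling m n
  f = cyclic w L

  Q F : ℕ
  Q = laps w 0 L
  F = arcsEnd w 0 L

  Q*w+F≡sum : Q * w + F ≡ sum L
  Q*w+F≡sum = proj₁ (laps*w+arcsEnd L w>0 L≤w)

  F<w : F < w
  F<w = proj₂ (laps*w+arcsEnd L w>0 L≤w)

  private
    length-rows : length (arcs w 0 L) ≡ m
    length-rows = trans (length-arcs 0 L) length≡m

  sumF-degA1 : ∀ G → sumF (λ a → G (degA1 f a)) ≡ sum (map G L)
  sumF-degA1 G = trans (sumF-rowAt (arcs w 0 L) length-rows (λ r → G (count {n} (λ b → r (toℕ b)))))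
                       (sum-count-arcs L w≤n w>0 L≤w G)

  degB1≡ : ∀ b → degB1 f b ≡ Q * bit (toℕ b <ᵇ w) + bit (toℕ b <ᵇ F)
  degB1≡ b = begin
    degB1 f b                                             ≡⟨ count≡sumF-bit (λ a → f a b) ⟩
    sumF (λ a → bit (f a b))                              ≡⟨ sumF-rowAt (arcs w 0 L) length-rows (λ r → bit (r (toℕ b))) ⟩
    sum (map (λ r → bit (r (toℕ b))) (arcs w 0 L))        ≡⟨ +-identityʳ _ ⟨
    sum (map (λ r → bit (r (toℕ b))) (arcs w 0 L)) + 0    ≡⟨ column-arcs L w>0 L≤w (toℕ b) ⟩
    Q * bit (toℕ b <ᵇ w) + bit (toℕ b <ᵇ F)               ∎
    where open ≡-Reasoning

  e1≡sum : e1 f ≡ sum L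
  e1≡sum = trans (sumF-degA1 (λ e → e)) (cong sum (map-id L))

sum-replicate : ∀ c v → sum (replicate c v) ≡ c * v
sum-replicate zero    v = refl
sum-replicate (suc c) v = cong (v +_) (sum-replicate c v)

-- Realising every value up to the bound

profile : (h x z c τ rest : ℕ) → List ℕ
profile h x z c τ rest = replicate x (suc h) ++ replicate z 0 ++ replicate c (h ∸ τ) ++ replicate rest h

module _ (h x z c τ rest : ℕ) where
  length-profile : length (profile h x z c τ rest) ≡ x + (z + (c + rest))
  length-profile =
    trans (length-++ (replicate x (suc h))) (cong₂ _+_ (length-replicate x)
      (trans (length-++ (replicate z 0)) (cong₂ _+_ (length-replicate z)
        (trans (length-++ (replicate c (h ∸ τ))) (cong₂ _+_ (length-replicate c) (length-replicate rest))))))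

  sum-map-profile : ∀ G → sum (map G (profile h x z c τ rest)) ≡ x * G (suc h) + (z * G 0 + (c * G (h ∸ τ) + rest * G h))
  sum-map-profile G =
    trans (sum-map-++ (replicate x (suc h)) _) (cong₂ _+_ (block x (suc h))
      (trans (sum-map-++ (replicate z 0) _) (cong₂ _+_ (block z 0)
        (trans (sum-map-++ (replicate c (h ∸ τ)) _) (cong₂ _+_ (block c (h ∸ τ)) (block rest h))))))
    where
    sum-map-++ : ∀ X Y → sum (map G (X ++ Y)) ≡ sum (map G X) + sum (map G Y)
    sum-map-++ X Y = trans (cong sum (map-++ G X Y)) (sum-++ (map G X) (map G Y))
    block : ∀ c v → sum (map G (replicate c v)) ≡ c * G v
    block c v = trans (cong sum (map-replicate G c v)) (sum-replicate c (G v))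

  count-profile-above : sum (map (λ e → bit (h <ᵇ e)) (profile h x z c τ rest)) ≡ x
  count-profile-above
    rewrite sum-map-profile (λ e → bit (h <ᵇ e))
          | <⇒<ᵇ≡true (n<1+n h) | ≥⇒<ᵇ≡false (m∸n≤m h τ) | ≥⇒<ᵇ≡false (≤-refl {h})
    = solve (x ∷ z ∷ c ∷ rest ∷ [])

  count-profile-below : 1 ≤ τ → τ ≤ h → sum (map (λ e → bit (e <ᵇ h)) (profile h x z c τ rest)) ≡ z + c
  count-profile-below τ≥1 τ≤h
    rewrite sum-map-profile (λ e → bit (e <ᵇ h))
          | ≥⇒<ᵇ≡false (n≤1+n h) | <⇒<ᵇ≡true (≤-trans τ≥1 τ≤h) | <⇒<ᵇ≡true (∸-monoʳ-< {h} {τ} {0} τ≥1 τ≤h)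
          | ≥⇒<ᵇ≡false (≤-refl {h})
    = solve (x ∷ z ∷ c ∷ rest ∷ [])

  profile-≤ : ∀ {w} → suc h ≤ w → All (_≤ w) (profile h x z c τ rest)
  profile-≤ {w} h<w = ++⁺ (replicate⁺ x h<w) (++⁺ (replicate⁺ z z≤n)
                      (++⁺ (replicate⁺ c (≤-trans (m∸n≤m h τ) h≤w)) (replicate⁺ rest h≤w)))
    where
    h≤w : h ≤ w
    h≤w = ≤-trans (n≤1+n h) h<w

  sum-profile : τ ≤ h → x ≡ z * h + c * τ → sum (profile h x z c τ rest) ≡ (x + (z + (c + rest))) * h
  sum-profile τ≤h refl = begin
    sum (profile h x z c τ rest)
      ≡⟨ cong sum (map-id (profile h x z c τ rest)) ⟨
    sum (map (λ e → e) (profile h x z c τ rest))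
      ≡⟨ sum-map-profile (λ e → e) ⟩
    (z * h + c * τ) * suc h + (z * 0 + (c * (h ∸ τ) + rest * h))
      ≡⟨ balance τ≤h ⟩
    (z * h + c * τ + (z + (c + rest))) * h
      ∎
    where
    open ≡-Reasoning
    balance : ∀ {h} → τ ≤ h → (z * h + c * τ) * suc h + (z * 0 + (c * (h ∸ τ) + rest * h))
                              ≡ (z * h + c * τ + (z + (c + rest))) * h
    balance {h} τ≤h with h ∸ τ | m+[n∸m]≡n τ≤h
    ... | μ | refl = solve (z ∷ c ∷ τ ∷ μ ∷ rest ∷ [])

quotient-unique : ∀ {w Q F Q′ F′} → F < w → F′ < w → Q * w + F ≡ Q′ * w + F′ → Q ≡ Q′ × F ≡ F′
quotient-unique {suc w′} {Q} {F} {Q′} {F′} F<w F′<w eq =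
  *-cancelʳ-≡ Q Q′ w (+-cancelʳ-≡ F (Q * w) (Q′ * w) (trans eq (cong (Q′ * w +_) (sym F≡F′)))) , F≡F′
  where
  open ≡-Reasoning
  w = suc w′
  F≡F′ : F ≡ F′
  F≡F′ = begin
    F                ≡⟨ m<n⇒m%n≡m F<w ⟨
    F % w            ≡⟨ [m+kn]%n≡m%n F Q w ⟨
    (F + Q * w) % w  ≡⟨ cong (_% w) (trans (+-comm F (Q * w)) (trans eq (+-comm (Q′ * w) F′))) ⟩
    (F′ + Q′ * w) % w ≡⟨ [m+kn]%n≡m%n F′ Q′ w ⟩
    F′ % w           ≡⟨ m<n⇒m%n≡m F′<w ⟩
    F′               ∎

-- A-degrees realising vA1 - vA0 = j with e(1) = m h: the j + z + c rows of degree h + 1 carry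
-- exactly the z h + c τ ones missing from the z + c rows labeled 0.
record RowPlan (h j m : ℕ) : Set where
  field
    z c τ rest : ℕ
    τ≥1     : 1 ≤ τ
    τ≤h     : τ ≤ h
    balance : j + (z + c) ≡ z * h + c * τ
    size    : j + (z + c) + (z + (c + rest)) ≡ m

  x : ℕ
  x = j + (z + c)

  rows : List ℕ
  rows = profile h x z c τ rest

empty-plan : ∀ {h m} → 1 ≤ h → RowPlan h 0 m
empty-plan {h} {m} h≥1 = record
  { z = 0 ; c = 0 ; τ = 1 ; rest = m ; τ≥1 = ≤-refl ; τ≤h = h≥1 ; balance = refl ; size = refl }

-- Writing j = z h′ + t with t < h′ and c = [t > 0], the plan needs j + 2 (z + c) labeled rows;
-- the room is Q (h′ + 2) rows, plus R + 2 more when R > 0.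
plan-fits : ∀ {h′ Q R z t c M} → t < h′ → R < h′ → z * h′ + t ≤ Q * h′ + R →
            (c ≡ 0 × t ≡ 0) ⊎ (c ≡ 1 × 1 ≤ t) →
            Q * (h′ + 2) ≤ M → (1 ≤ R → Q * (h′ + 2) + (R + 2) ≤ M) → z * h′ + t + 2 * (z + c) ≤ M
plan-fits {h′} {Q} {R} {z} {t} {c} t<h′ R<h′ j≤ c-cases QM RM with <-cmp z Q
... | tri< z<Q _ _ = ≤-trans (<⇒≤ (begin-strict
  z * h′ + t + 2 * (z + c)   ≤⟨ +-monoʳ-≤ (z * h′ + t) (*-monoʳ-≤ 2 (+-monoʳ-≤ z c≤1)) ⟩
  z * h′ + t + 2 * (z + 1)   <⟨ +-monoˡ-< (2 * (z + 1)) (+-monoʳ-< (z * h′) t<h′) ⟩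
  z * h′ + h′ + 2 * (z + 1)  ≡⟨ solve (z ∷ h′ ∷ []) ⟩
  suc z * (h′ + 2)           ≤⟨ *-monoˡ-≤ (h′ + 2) z<Q ⟩
  Q * (h′ + 2)               ∎)) QM
  where
  open ≤-Reasoning
  c≤1 : c ≤ 1
  c≤1 = [ (λ { (refl , _) → z≤n }) , (λ { (refl , _) → ≤-refl }) ]′ c-cases
... | tri> _ _ Q<z = ⊥-elim (<⇒≱ (begin-strict
  Q * h′ + R   <⟨ +-monoʳ-< (Q * h′) R<h′ ⟩
  Q * h′ + h′  ≡⟨ +-comm (Q * h′) h′ ⟩
  suc Q * h′   ≤⟨ *-monoˡ-≤ h′ Q<z ⟩
  z * h′       ≤⟨ m≤m+n (z * h′) t ⟩
  z * h′ + t   ∎) j≤)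
  where open ≤-Reasoning
... | tri≈ _ refl _ with c-cases
... | inj₁ (refl , refl) = ≤-trans (≤-reflexive z*h′+2*z≡) QM
  where
  z*h′+2*z≡ : z * h′ + 0 + 2 * (z + 0) ≡ z * (h′ + 2)
  z*h′+2*z≡ = solve (z ∷ h′ ∷ [])
... | inj₂ (refl , t≥1)  = ≤-trans (begin
  z * h′ + t + 2 * (z + 1)   ≡⟨ solve (z ∷ h′ ∷ t ∷ []) ⟩
  z * (h′ + 2) + (t + 2)     ≤⟨ +-monoʳ-≤ (z * (h′ + 2)) (+-monoˡ-≤ 2 t≤R) ⟩
  z * (h′ + 2) + (R + 2)     ∎) (RM (≤-trans t≥1 t≤R))
  where
  open ≤-Reasoning
  t≤R : t ≤ R
  t≤R = +-cancelˡ-≤ (z * h′) t R j≤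

size-rearrange : ∀ j z c rest → j + (z + c) + (z + (c + rest)) ≡ j + 2 * (z + c) + rest
size-rearrange = solve-∀

plan-from-division : ∀ {h′ m Q R} z t → t < h′ → R < h′ → z * h′ + t ≤ Q * h′ + R →
                     Q * (h′ + 2) ≤ m → (1 ≤ R → Q * (h′ + 2) + (R + 2) ≤ m) → RowPlan (suc h′) (z * h′ + t) m
plan-from-division {h′} {m} {Q} {R} z zero t<h′ R<h′ j≤ QM RM = record
  { z = z ; c = 0 ; τ = 1 ; rest = m ∸ (z * h′ + 0 + 2 * (z + 0))
  ; τ≥1 = ≤-refl ; τ≤h = s≤s z≤n
  ; balance = solve (z ∷ h′ ∷ [])
  ; size = trans (size-rearrange (z * h′ + 0) z 0 _)
                 (m+[n∸m]≡n (plan-fits {h′} {Q} {R} {z} t<h′ R<h′ j≤ (inj₁ (refl , refl)) QM RM)) }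
plan-from-division {h′} {m} {Q} {R} z (suc t) t<h′ R<h′ j≤ QM RM = record
  { z = z ; c = 1 ; τ = suc (suc t) ; rest = m ∸ (z * h′ + suc t + 2 * (z + 1))
  ; τ≥1 = s≤s z≤n ; τ≤h = s≤s (<⇒≤ t<h′)
  ; balance = solve (z ∷ h′ ∷ t ∷ [])
  ; size = trans (size-rearrange (z * h′ + suc t) z 1 _)
                 (m+[n∸m]≡n (plan-fits {h′} {Q} {R} {z} t<h′ R<h′ j≤ (inj₂ (refl , s≤s z≤n)) QM RM)) }

row-plan : ∀ {h′ j m Q R} → 1 ≤ h′ → R < h′ → j ≤ Q * h′ + R →
           Q * (h′ + 2) ≤ m → (1 ≤ R → Q * (h′ + 2) + (R + 2) ≤ m) → RowPlan (suc h′) j m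
row-plan {suc h″} {j} {m} {Q} {R} _ R<h′ j≤ QM RM =
  subst (λ j → RowPlan (suc h′) j m) (sym j≡) (plan-from-division {h′} {m} {Q} {R} (j / h′) (j % h′) (m%n<n j h′) R<h′ (subst (_≤ _) j≡ j≤) QM RM)
  where
  h′ : ℕ
  h′ = suc h″
  j≡ : j ≡ j / h′ * h′ + j % h′
  j≡ = trans (m≡m%n+[m/n]*n j h′) (+-comm (j % h′) (j / h′ * h′))

module PlanLabeling {k h j : ℕ} (plan : RowPlan h j (suc (k + k))) {w : ℕ} (h<w : suc h ≤ w) (w≤n : w ≤ h + h) where
  open RowPlan plan
  private
    m n : ℕ
    m = suc (k + k)
    n = h + h
    h≥1 : 1 ≤ h
    h≥1 = ≤-trans τ≥1 τ≤h

    length-rows : length rows ≡ m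
    length-rows = trans (length-profile h x z c τ rest) size
    w>0 : 0 < w
    w>0 = ≤-trans z<s h<w
    rows≤w : All (_≤ w) rows
    rows≤w = profile-≤ h x z c τ rest h<w

  open Cyclic {m} {n} {w} rows length-rows w≤n w>0 rows≤w public

  sum-rows : sum rows ≡ m * h
  sum-rows = trans (sum-profile h x z c τ rest τ≤h balance) (cong (_* h) size)

  Q*w+F≡m*h : Q * w + F ≡ m * h
  Q*w+F≡m*h = trans Q*w+F≡sum sum-rows

  valid : Surjective f × EdgeFriendly f
  valid = friendly-surjective f (trans e1≡sum sum-rows) (*-mono-≤ {1} {m} (s≤s z≤n) h≥1)

  vA1≡ : vA1 f ≡ x
  vA1≡ = begin
    vA1 f                                      ≡⟨ vA1≡count {h = h} f ⟩
    count (λ a → h <ᵇ degA1 f a)               ≡⟨ count≡sumF-bit (λ a → h <ᵇ degA1 f a) ⟩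
    sumF (λ a → bit (h <ᵇ degA1 f a))          ≡⟨ sumF-degA1 (λ e → bit (h <ᵇ e)) ⟩
    sum (map (λ e → bit (h <ᵇ e)) rows)        ≡⟨ count-profile-above h x z c τ rest ⟩
    x                                          ∎
    where open ≡-Reasoning

  vA0≡ : vA0 f ≡ z + c
  vA0≡ = begin
    vA0 f                                      ≡⟨ vA0≡count {h = h} f ⟩
    count (λ a → degA1 f a <ᵇ h)               ≡⟨ count≡sumF-bit (λ a → degA1 f a <ᵇ h) ⟩
    sumF (λ a → bit (degA1 f a <ᵇ h))          ≡⟨ sumF-degA1 (λ e → bit (e <ᵇ h)) ⟩
    sum (map (λ e → bit (e <ᵇ h)) rows)        ≡⟨ count-profile-below h x z c τ rest τ≥1 τ≤h ⟩
    z + c                                      ∎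
    where open ≡-Reasoning

<ᵇ-+bit : ∀ k t → (k <ᵇ k + bit t) ≡ t
<ᵇ-+bit k true  = <⇒<ᵇ≡true (m<m+n k z<s)
<ᵇ-+bit k false = ≥⇒<ᵇ≡false (≤-reflexive (+-identityʳ k))

+bit-<ᵇ : ∀ k t → (k + bit t <ᵇ suc k) ≡ not t
+bit-<ᵇ k true  = ≥⇒<ᵇ≡false (≤-reflexive (+-comm 1 k))
+bit-<ᵇ k false = <⇒<ᵇ≡true (s≤s (≤-reflexive (+-identityʳ k)))

∣j+y+d-y+d∣ : ∀ j y d → ∣ j + y + d - (y + d) ∣ ≡ j
∣j+y+d-y+d∣ j y d = begin
  ∣ j + y + d - (y + d) ∣    ≡⟨ cong ∣_- y + d ∣ (trans (+-assoc j y d) (+-comm j (y + d))) ⟩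
  ∣ (y + d) + j - (y + d) ∣  ≡⟨ ∣-∣-comm ((y + d) + j) (y + d) ⟩
  ∣ (y + d) - (y + d) + j ∣  ≡⟨ ∣m-m+n∣≡n (y + d) j ⟩
  j                          ∎
  where open ≡-Reasoning

suc≤double : ∀ {h} → 1 ≤ h → suc h ≤ h + h
suc≤double {h} h≥1 = subst (_≤ h + h) (+-comm h 1) (+-monoʳ-≤ h h≥1)

∣j+y+w-y+1∣ : ∀ j y h → ∣ j + y + (suc h + h) - (y + 1) ∣ ≡ j + (h + h)
∣j+y+w-y+1∣ j y h = trans (cong ∣_- y + 1 ∣ rearrange) (∣j+y+d-y+d∣ (j + (h + h)) y 1)
  where
  rearrange : j + y + (suc h + h) ≡ j + (h + h) + y + 1
  rearrange = solve (j ∷ y ∷ h ∷ [])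

-- Filling the full width n = 2h balances every column at k or k + 1, so vB1 = vB0 = h.
balanced-realization : ∀ {k h j} → RowPlan h j (suc (k + k)) → InEBI (suc (k + k)) (h + h) j
balanced-realization {k} {h} {j} plan = f , proj₁ valid , proj₂ valid , sym ∣v1-v0∣≡
  where
  open RowPlan plan
  h≥1 : 1 ≤ h
  h≥1 = ≤-trans τ≥1 τ≤h
  open PlanLabeling {k} plan {h + h} (suc≤double h≥1) ≤-refl

  Q≡k×F≡h : Q ≡ k × F ≡ h
  Q≡k×F≡h = quotient-unique F<w (m<m+n h h≥1) (trans Q*w+F≡m*h m*h≡)
    where
    m*h≡ : suc (k + k) * h ≡ k * (h + h) + h
    m*h≡ = solve (k ∷ h ∷ [])

  degB1≡k+ : ∀ b → degB1 f b ≡ k + bit (toℕ b <ᵇ h)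
  degB1≡k+ b rewrite degB1≡ b | proj₁ Q≡k×F≡h | proj₂ Q≡k×F≡h | <⇒<ᵇ≡true (toℕ<n b) = cong (_+ bit (toℕ b <ᵇ h)) (*-identityʳ k)

  vB1≡h : vB1 f ≡ h
  vB1≡h = trans (vB1≡count {k = k} f) (trans (count-cong λ b → trans (cong (k <ᵇ_) (degB1≡k+ b)) (<ᵇ-+bit k (toℕ b <ᵇ h)))
                                             (count-toℕ< (h + h) h (m≤m+n h h)))

  vB0≡h : vB0 f ≡ h
  vB0≡h = trans (vB0≡count {k = k} f) (trans (count-cong λ b → trans (cong (_<ᵇ suc k) (degB1≡k+ b)) (+bit-<ᵇ k (toℕ b <ᵇ h)))
                                             (count-not (λ b → toℕ b <ᵇ h) (count-toℕ< (h + h) h (m≤m+n h h)) refl))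

  ∣v1-v0∣≡ : ∣ v1 f - v0 f ∣ ≡ j
  ∣v1-v0∣≡ = begin
    ∣ vA1 f + vB1 f - (vA0 f + vB0 f) ∣  ≡⟨ cong₂ ∣_-_∣ (cong₂ _+_ vA1≡ vB1≡h) (cong₂ _+_ vA0≡ vB0≡h) ⟩
    ∣ j + (z + c) + h - (z + c + h) ∣    ≡⟨ ∣j+y+d-y+d∣ j (z + c) h ⟩
    j                                    ∎
    where open ≡-Reasoning

laps-fit : ∀ {h k} → h ≤ k → suc k * (suc h + h) ≤ suc (k + k) * suc h
laps-fit {h} {k} h≤k with k ∸ h | m+[n∸m]≡n h≤k
... | d | refl = ≤-trans (m≤m+n (suc (h + d) * (suc h + h)) d) (≤-reflexive (solve (h ∷ d ∷ [])))

-- Filling only w = n - 1 columns forces more than k ones into each of them and none into the last column,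
-- so vB1 = n - 1 and vB0 = 1.
shifted-realization : ∀ {k h j} → 1 ≤ h → suc h ≤ k → RowPlan (suc h) j (suc (k + k)) →
                      InEBI (suc (k + k)) (suc h + suc h) (j + (h + h))
shifted-realization {k} {h} {j} h≥1 h<k plan = f , proj₁ valid , proj₂ valid , sym ∣v1-v0∣≡
  where
  open RowPlan plan
  n w : ℕ
  n = suc h + suc h
  w = suc h + h
  w≤n : w ≤ n
  w≤n = +-monoʳ-≤ (suc h) (n≤1+n h)
  open PlanLabeling {k} plan {w} (s≤s (suc≤double h≥1)) w≤n

  k<Q : k < Q
  k<Q = ≰⇒> λ Q≤k → <-irrefl Q*w+F≡m*h (begin-strict
    Q * w + F            <⟨ +-monoʳ-< (Q * w) F<w ⟩
    Q * w + w            ≡⟨ +-comm (Q * w) w ⟩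
    suc Q * w            ≤⟨ *-monoˡ-≤ w (s≤s Q≤k) ⟩
    suc k * w            ≤⟨ laps-fit (≤-trans (n≤1+n h) h<k) ⟩
    suc (k + k) * suc h  ∎)
    where open ≤-Reasoning

  column : ∀ b → ((toℕ b <ᵇ w) ≡ true × k < degB1 f b) ⊎ ((toℕ b <ᵇ w) ≡ false × degB1 f b ≡ 0)
  column b with toℕ b <ᵇ w in b<ᵇw
  ... | true  = inj₁ (refl , <-≤-trans k<Q (begin
    Q                                          ≡⟨ *-identityʳ Q ⟨
    Q * 1                                      ≤⟨ m≤m+n (Q * 1) (bit (toℕ b <ᵇ F)) ⟩
    Q * 1 + bit (toℕ b <ᵇ F)                   ≡⟨ cong (λ t → Q * bit t + bit (toℕ b <ᵇ F)) b<ᵇw ⟨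
    Q * bit (toℕ b <ᵇ w) + bit (toℕ b <ᵇ F)    ≡⟨ degB1≡ b ⟨
    degB1 f b                                  ∎))
    where open ≤-Reasoning
  ... | false = inj₂ (refl , (begin
    degB1 f b                                  ≡⟨ degB1≡ b ⟩
    Q * bit (toℕ b <ᵇ w) + bit (toℕ b <ᵇ F)    ≡⟨ cong₂ (λ t u → Q * bit t + bit u) b<ᵇw
                                                   (≥⇒<ᵇ≡false (≤-trans (<⇒≤ F<w) (<ᵇ≡false⇒≥ b<ᵇw))) ⟩
    Q * 0 + 0                                  ≡⟨ trans (+-identityʳ (Q * 0)) (*-zeroʳ Q) ⟩
    0                                          ∎))
    where open ≡-Reasoning

  vB1≡w : vB1 f ≡ w
  vB1≡w = trans (vB1≡count {k = k} f) (trans (count-cong label) (count-toℕ< n w w≤n))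
    where
    label : ∀ b → (k <ᵇ degB1 f b) ≡ (toℕ b <ᵇ w)
    label b with column b
    ... | inj₁ (b<w , k<d) = trans (<⇒<ᵇ≡true k<d) (sym b<w)
    ... | inj₂ (b≮w , d≡0) = trans (cong (k <ᵇ_) d≡0) (sym b≮w)

  vB0≡1 : vB0 f ≡ 1
  vB0≡1 = trans (vB0≡count {k = k} f) (trans (count-cong label)
            (count-not {n} (λ b → toℕ b <ᵇ w) (count-toℕ< n w w≤n) (trans (+-assoc (suc h) h 1) (cong (suc h +_) (+-comm h 1)))))
    where
    label : ∀ b → (degB1 f b <ᵇ suc k) ≡ not (toℕ b <ᵇ w)
    label b with column b
    ... | inj₁ (b<w , k<d) = trans (≥⇒<ᵇ≡false k<d) (sym (cong not b<w))
    ... | inj₂ (b≮w , d≡0) = trans (cong (_<ᵇ suc k) d≡0) (sym (cong not b≮w))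

  ∣v1-v0∣≡ : ∣ v1 f - v0 f ∣ ≡ j + (h + h)
  ∣v1-v0∣≡ = begin
    ∣ vA1 f + vB1 f - (vA0 f + vB0 f) ∣          ≡⟨ cong₂ ∣_-_∣ (cong₂ _+_ vA1≡ vB1≡w) (cong₂ _+_ vA0≡ vB0≡1) ⟩
    ∣ j + (z + c) + (suc h + h) - (z + c + 1) ∣  ≡⟨ ∣j+y+w-y+1∣ j (z + c) h ⟩
    j + (h + h)                                  ∎
    where open ≡-Reasoning

small-realizable : ∀ {k h′ K} → 1 ≤ h′ → suc h′ + suc h′ < suc (k + k) → suc (suc (suc K)) ≤ suc h′ + suc h′ →
                   InEBI (suc (k + k)) (suc h′ + suc h′) K
small-realizable {k} {suc h″} {K} _ n<m K+3≤n = balanced-realization {k} (row-plan {Q = 1} {R = h″} (s≤s z≤n) ≤-refl K≤ QM RM)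
  where
  K≤ : K ≤ 1 * suc h″ + h″
  K≤ = ≤-pred (≤-pred (≤-pred (subst (suc (suc (suc K)) ≤_) n≡ K+3≤n)))
    where
    n≡ : suc (suc h″) + suc (suc h″) ≡ suc (suc (suc (1 * suc h″ + h″)))
    n≡ = solve (h″ ∷ [])
  QM : 1 * (suc h″ + 2) ≤ suc (k + k)
  QM = ≤-trans (m≤m+n (1 * (suc h″ + 2)) (suc h″)) (≤-trans (≤-reflexive n≡) (<⇒≤ n<m))
    where
    n≡ : 1 * (suc h″ + 2) + suc h″ ≡ suc (suc h″) + suc (suc h″)
    n≡ = solve (h″ ∷ [])
  RM : 1 ≤ h″ → 1 * (suc h″ + 2) + (h″ + 2) ≤ suc (k + k)
  RM _ = subst (_≤ suc (k + k)) (sym n+1≡) n<m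
    where
    n+1≡ : 1 * (suc h″ + 2) + (h″ + 2) ≡ suc (suc (suc h″) + suc (suc h″))
    n+1≡ = solve (h″ ∷ [])

module _ {k h′ : ℕ} (h′≥1 : 1 ≤ h′) (n<m : suc h′ + suc h′ < suc (k + k)) where
  private
    m n : ℕ
    m = suc (k + k)
    n = suc h′ + suc h′

  h<k : suc h′ ≤ k
  h<k = ≰⇒> λ k≤h′ → <⇒≱ n<m (s≤s (+-mono-≤ k≤h′ (≤-trans k≤h′ (n≤1+n h′))))

  large-realizable : ∀ {q c R K} → m ≡ q * suc (suc h′) + (c + R) → R < h′ → (1 ≤ R → c ≡ 2) →
                     h′ + h′ ≤ K → K ≤ q * h′ + R + (h′ + h′) → InEBI m n K
  large-realizable {q} {c} {R} {K} m≡ R<h′ R>0⇒c≡2 2h′≤K K≤ =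
    subst (InEBI m n) (m∸n+n≡m 2h′≤K) (shifted-realization {k} h′≥1 h<k (row-plan {Q = q} {R = R} h′≥1 R<h′ j≤ QM RM))
    where
    j≤ : K ∸ (h′ + h′) ≤ q * h′ + R
    j≤ = +-cancelʳ-≤ (h′ + h′) _ _ (subst (_≤ q * h′ + R + (h′ + h′)) (sym (m∸n+n≡m 2h′≤K)) K≤)
    m≡′ : m ≡ q * (h′ + 2) + (c + R)
    m≡′ = trans m≡ (cong (λ t → q * t + (c + R)) (+-comm 2 h′))
    QM : q * (h′ + 2) ≤ m
    QM = subst (q * (h′ + 2) ≤_) (sym m≡′) (m≤m+n (q * (h′ + 2)) (c + R))
    RM : 1 ≤ R → q * (h′ + 2) + (R + 2) ≤ m
    RM R≥1 = ≤-reflexive (sym (trans m≡′ (cong (q * (h′ + 2) +_) (trans (cong (_+ R) (R>0⇒c≡2 R≥1)) (+-comm 2 R)))))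

  ebi-bound≡ : ∀ {q c R} → m ≡ q * suc (suc h′) + (c + R) → m + n ∸ 2 * q ∸ (c + 2) ≡ q * h′ + R + (h′ + h′)
  ebi-bound≡ {q} {c} {R} m≡ = begin
    m + n ∸ 2 * q ∸ (c + 2)                                  ≡⟨ ∸-+-assoc (m + n) (2 * q) (c + 2) ⟩
    m + n ∸ (2 * q + (c + 2))                                ≡⟨ cong (λ t → t + n ∸ (2 * q + (c + 2))) m≡ ⟩
    q * suc (suc h′) + (c + R) + n ∸ (2 * q + (c + 2))       ≡⟨ cong (_∸ (2 * q + (c + 2))) rearrange ⟩
    q * h′ + R + (h′ + h′) + (2 * q + (c + 2)) ∸ (2 * q + (c + 2))  ≡⟨ m+n∸n≡m _ (2 * q + (c + 2)) ⟩
    q * h′ + R + (h′ + h′)                                   ∎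
    where
    open ≡-Reasoning
    rearrange : q * suc (suc h′) + (c + R) + (suc h′ + suc h′) ≡ q * h′ + R + (h′ + h′) + (2 * q + (c + 2))
    rearrange = solve (q ∷ c ∷ R ∷ h′ ∷ [])

  ebi-≥ : ∀ {q c R K} → m ≡ q * suc (suc h′) + (c + R) → R < h′ → (1 ≤ R → c ≡ 2) →
          K ≤ m + n ∸ 2 * q ∸ (c + 2) → InEBI m n K
  ebi-≥ {q} {c} {R} {K} m≡ R<h′ R>0⇒c≡2 K≤ with suc (suc (suc K)) ≤? n
  ... | yes K+3≤n = small-realizable {k} h′≥1 n<m K+3≤n
  ... | no  K+3≰n = large-realizable {q} {c} {R} m≡ R<h′ R>0⇒c≡2 2h′≤K (subst (K ≤_) (ebi-bound≡ {q} {c} {R} m≡) K≤)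
    where
    2h′≤K : h′ + h′ ≤ K
    2h′≤K = ≤-pred (≤-pred (subst (_≤ suc (suc K)) (cong suc (+-suc h′ h′)) (≤-pred (≰⇒> K+3≰n))))

  ebi⇔ : ∀ {q c R} → m ≡ q * suc (suc h′) + (c + R) → c ≤ 2 → R < h′ → (1 ≤ R → c ≡ 2) →
         ∀ K → InEBI m n K ⇔ K ≤ m + n ∸ 2 * q ∸ (c + 2)
  ebi⇔ {q} {c} {R} m≡ c≤2 R<h′ R>0⇒c≡2 K = mk⇔
    (λ (f , _ , friendly , K≡) → subst (_≤ m + n ∸ 2 * q ∸ (c + 2)) (sym K≡)
                                   (UpperBound.ebi-≤ {k} {suc h′} f (s≤s z≤n) friendly {q} m≡ (m≤m+n c R) c≤2))
    (ebi-≥ {q} {c} {R} {K} m≡ R<h′ R>0⇒c≡2)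

ebi⇔≡0 : ∀ k K → InEBI (suc (k + k)) 2 K ⇔ K ≡ 0
ebi⇔≡0 k K = mk⇔
  (λ (f , _ , friendly , K≡) → trans K≡ (UpperBound.ebi≡0 {k} {1} f ≤-refl friendly refl))
  (λ { refl → balanced-realization {k} (empty-plan ≤-refl) })

odd⇒suc-double : ∀ {m} → ¬ 2 ∣ m → Σ ℕ λ k → m ≡ suc (k + k)
odd⇒suc-double {zero}        ¬2∣m = ⊥-elim (¬2∣m (divides 0 refl))
odd⇒suc-double {suc zero}    _    = 0 , refl
odd⇒suc-double {suc (suc m)} ¬2∣m with odd⇒suc-double {m} (λ 2∣m → ¬2∣m (∣m∣n⇒∣m+n (∣-refl {2}) 2∣m))
... | k , refl = suc k , cong (λ t → suc (suc t)) (sym (+-suc k k))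

even⇒double : ∀ {n} → 2 ∣ n → Σ ℕ λ h → n ≡ h + h
even⇒double (divides h refl) = h , trans (*-comm h 2) (cong (h +_) (+-identityʳ h))

double/2≡ : ∀ h → (h + h) / 2 ≡ h
double/2≡ h = trans (cong (_/ 2) (sym (trans (*-comm h 2) (cong (h +_) (+-identityʳ h))))) (m*n/n≡m h 2)

theorem3p1 : (m n : ℕ) → ¬ (2 ∣ m) → 2 ∣ n → n < m → 2 ≤ n →
    (n ≡ 2 → ∀ k → InEBI m n k ⇔ k ≡ 0)
    × (4 ≤ n →
    let q = m / suc (n / 2)
        r = m % suc (n / 2)
    in (r ≡ 0 → ∀ k → InEBI m n k ⇔ k ≤ m + n ∸ 2 * q ∸ 2)
     × (r ≡ 1 → ∀ k → InEBI m n k ⇔ k ≤ m + n ∸ 2 * q ∸ 3)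
     × (2 ≤ r → ∀ k → InEBI m n k ⇔ k ≤ m + n ∸ 2 * q ∸ 4))
theorem3p1 m n ¬2∣m 2∣n n<m 2≤n with odd⇒suc-double ¬2∣m | even⇒double 2∣n
... | k , refl | zero , refl = ⊥-elim (<⇒≱ 2≤n z≤n)
... | k , refl | suc zero , refl = (λ _ → ebi⇔≡0 k) , λ { (s≤s (s≤s ())) }
... | k , refl | suc (suc h″) , refl rewrite double/2≡ (suc (suc h″)) =
  (λ n≡2 → ⊥-elim (m+1+n≢0 h″ (suc-injective (suc-injective n≡2)))) , λ _ →
    (λ r≡0 → ebi⇔ {k} h′≥1 n<m {q} {0} {0} (subst (λ r → m ≡ q * suc h + r) r≡0 m≡) z≤n z<s λ ())
  , (λ r≡1 → ebi⇔ {k} h′≥1 n<m {q} {1} {0} (subst (λ r → m ≡ q * suc h + r) r≡1 m≡) (s≤s z≤n) z<s λ ())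
  , (λ r≥2 → ebi⇔ {k} h′≥1 n<m {q} {2} {r ∸ 2} (trans m≡ (cong (q * suc h +_) (sym (m+[n∸m]≡n r≥2))))
                  ≤-refl (m<n+o⇒m∸n<o r 2 (m%n<n m (suc h))) λ _ → refl)
  where
  h′ h q r : ℕ
  h′ = suc h″
  h = suc h′
  q = m / suc h
  r = m % suc h
  h′≥1 : 1 ≤ h′
  h′≥1 = s≤s z≤n
  m≡ : m ≡ q * suc h + r
  m≡ = trans (m≡m%n+[m/n]*n m (suc h)) (+-comm r (q * suc h))
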